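{- Let $e,f$ be two disjoint sequences of nonzero vectors in $\mathbb N^d$ with $|e|=|f|$, $\Delta\geq0$ on $[0,1]^d$ and $\Delta\geq1$ on $\mathcal D$, and let $p$ be a prime. For all $s\in\mathbb N$ and $\mathbf a\in\Psi_s(\mathcal N)$, we have $v_p(\mathcal Q(\mathbf a))=\sum_{\ell=1}^s\Delta(\{\mathbf a/p^\ell\})$.
   Context: For $e=(\mathbf e_1,\dots,\mathbf e_{q_1})$, $f=(\mathbf f_1,\dots,\mathbf f_{q_2})$: $\mathcal Q(\mathbf n)=\prod_i(\mathbf e_i\cdot\mathbf n)!/\prod_j(\mathbf f_j\cdot\mathbf n)!$; $\Delta(\mathbf x)=\sum_i\lfloor\mathbf e_i\cdot\mathbf x\rfloor-\sum_j\lfloor\mathbf f_j\cdot\mathbf x\rfloor$; $\mathcal D$ is the set of $\mathbf x\in[0,1)^d$ with $\mathbf d\cdot\mathbf x\geq1$ for some $\mathbf d\in\{\mathbf e_1,\dots,\mathbf f_{q_2}\}$; $\{\cdot\}$ is coordinatewise fractional part. $\mathcal N=\bigcup_{t\geq1}\big(\{\mathbf n\in\{0,\dots,p^t-1\}^d:\{\mathbf n/p^\ell\}\in\mathcal D\ \forall\ell\in\{1,\dots,t\}\}\times\{t\}\big)$, and $\Psi_s(\mathcal N)$ is the set of $\mathbf u\in\{0,\dots,p^s-1\}^d$ with $\mathbf u\neq\mathbf j+p^{s-t}\mathbf n$ for all $(\mathbf n,t)\in\mathcal N$ with $t\leq s$ and all $\mathbf j\in\{0,\dots,p^{s-t}-1\}^d$.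 -}

module Defs where

open import Data.Nat as ℕ using (ℕ; zero; suc; _^_; _!)
open import Data.Nat.Divisibility using (_∣?_)
open import Data.Nat.DivMod using (_/_)
open import Data.Integer as ℤ using (ℤ; +_)
open import Data.Rational as ℚ using (ℚ; floor)
open import Data.Fin using (Fin)
open import Relation.Nullary using (yes; no; ¬_)
open import Data.Product using (Σ)
open import Data.Sum using (_⊎_)
open import Relation.Binary.PropositionalEquality using (_≡_)

sumℕ : ∀ {n} → (Fin n → ℕ) → ℕ
sumℕ {zero} g = 0
sumℕ {suc n} g = g Data.Fin.zero ℕ.+ sumℕ (λ i → g (Data.Fin.suc i))


sumℤ : ∀ {n} → (Fin n → ℤ) → ℤ
sumℤ {zero} g = + 0
sumℤ {suc n} g = g Data.Fin.zero ℤ.+ sumℤ (λ i → g (Data.Fin.suc i))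

sumℚ : ∀ {n} → (Fin n → ℚ) → ℚ
sumℚ {zero} g = ℚ.0ℚ
sumℚ {suc n} g = g Data.Fin.zero ℚ.+ sumℚ (λ i → g (Data.Fin.suc i))

sumFrom1ℤ : ℕ → (ℕ → ℤ) → ℤ
sumFrom1ℤ zero g = + 0
sumFrom1ℤ (suc s) g = sumFrom1ℤ s g ℤ.+ g (suc s)

toℚ : ℕ → ℚ
toℚ n = (+ n) ℚ./ 1

-- n / m as a rational (m = 0 never occurs in uses below since m = p^ℓ, p prime)
divℚ : ℕ → ℕ → ℚ
divℚ n zero = ℚ.0ℚ
divℚ n (suc m) = (+ n) ℚ./ suc m

frac : ℚ → ℚ
frac x = x ℚ.- floor x ℚ./ 1

dot : ∀ {d} → (Fin d → ℕ) → (Fin d → ℚ) → ℚ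
dot v x = sumℚ (λ k → toℚ (v k) ℚ.* x k)

dotℕ : ∀ {d} → (Fin d → ℕ) → (Fin d → ℕ) → ℕ
dotℕ v n = sumℕ (λ k → v k ℕ.* n k)

-- p-adic valuation of a natural number (fuel-based; with fuel n it is exact
-- for n ≥ 1 and p ≥ 2).  v_p(0) is set to 0 by convention (never used: factorials).
vpFuel : ℕ → ℕ → ℕ → ℕ
vpFuel zero p n = 0
vpFuel (suc fuel) zero n = 0
vpFuel (suc fuel) (suc q) zero = 0
vpFuel (suc fuel) (suc q) (suc m) with suc q ∣? suc m
... | yes _ = suc (vpFuel fuel (suc q) (suc m / suc q))
... | no _ = 0

vp : ℕ → ℕ → ℕ
vp p n = vpFuel n p n

module Setup {d q₁ q₂ : ℕ} (e : Fin q₁ → Fin d → ℕ) (f : Fin q₂ → Fin d → ℕ) where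

  vpQ : ℕ → (Fin d → ℕ) → ℤ
  vpQ p n = sumℤ (λ i → + vp p (dotℕ (e i) n ! )) ℤ.- sumℤ (λ j → + vp p (dotℕ (f j) n !))

  Δ : (Fin d → ℚ) → ℤ
  Δ x = sumℤ (λ i → floor (dot (e i) x)) ℤ.- sumℤ (λ j → floor (dot (f j) x))

  record InD (x : Fin d → ℚ) : Set where
    field
      nonneg  : ∀ k → ℚ.0ℚ ℚ.≤ x k
      belowOne : ∀ k → x k ℚ.< ℚ.1ℚ
      someGe1 : (Σ (Fin q₁) λ i → ℚ.1ℚ ℚ.≤ dot (e i) x) ⊎ (Σ (Fin q₂) λ j → ℚ.1ℚ ℚ.≤ dot (f j) x)

  fracDiv : ℕ → ℕ → (Fin d → ℕ) → (Fin d → ℚ)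
  fracDiv p ℓ n k = frac (divℚ (n k) (p ^ ℓ))

  record InN (p : ℕ) (n : Fin d → ℕ) (t : ℕ) : Set where
    field
      t≥1 : 1 ℕ.≤ t
      bounded : ∀ k → n k ℕ.< p ^ t
      allD : ∀ ℓ → 1 ℕ.≤ ℓ → ℓ ℕ.≤ t → InD (fracDiv p ℓ n)

  record InΨ (p s : ℕ) (u : Fin d → ℕ) : Set where
    field
      bounded : ∀ k → u k ℕ.< p ^ s
      avoids : ∀ (n : Fin d → ℕ) (t : ℕ) → InN p n t → t ℕ.≤ s →
               ∀ (j : Fin d → ℕ) → (∀ k → j k ℕ.< p ^ (s ℕ.∸ t)) →
               ¬ (∀ k → u k ≡ j k ℕ.+ p ^ (s ℕ.∸ t) ℕ.* n k)

module Submission where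

-- Legendre's formula gives v_p(N!) = Σ_{ℓ=1}^{s} ⌊N/p^ℓ⌋ whenever N < p^(s+1).
-- The key point is that every factorial in 𝒬(a) is of this size: v·a < p^(s+1)
-- for each v among e_1,…,e_{q₁},f_1,…,f_{q₂} (lemma Bound.dot-bound).  If not,
-- the truncated dot products v·(a mod p^m) start below p^(m+1) at m = 0 and end
-- above it at m = s; at the last crossing m the digits of a above position m form
-- a point (⌊a/p^m⌋, s − m) of 𝒩 of which a is a descendant, contradicting
-- a ∈ Ψ_s(𝒩).  Given the bound, at each level ℓ splitting a = (a mod p^ℓ) +
-- p^ℓ⌊a/p^ℓ⌋ turns Σ_i ⌊e_i·a/p^ℓ⌋ − Σ_j ⌊f_j·a/p^ℓ⌋ into Δ({a/p^ℓ}), the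
-- integral parts cancelling because |e| = |f| (module Levels).

open import Defs
open import Data.Nat using (ℕ; zero; suc; _+_; _*_; _∸_; _^_; _!; _≤_; _<_; _⊓_; z≤n; s≤s; NonZero; NonTrivial; nonTrivial⇒n>1; nonTrivial⇒nonZero; >-nonZero; >-nonZero⁻¹)
open import Data.Nat.Properties
open import Data.Nat.DivMod
open import Data.Nat.Divisibility
open import Data.Nat.GCD using (gcd)
open import Data.Nat.Primality using (Prime; euclidsLemma; prime⇒nonTrivial)
open import Data.Integer as ℤ using (ℤ; +_; -[1+_])
import Data.Integer.Properties as ℤP
open import Data.Integer.Tactic.RingSolver using (solve-∀)
open import Data.Rational as ℚ using (ℚ; mkℚ; floor; toℚᵘ)
import Data.Rational.Properties as ℚP
open import Data.Rational.Unnormalised as ℚᵘ using (mkℚᵘ; *≡*; *≤*; *<*)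
import Data.Rational.Unnormalised.Properties as ℚᵘP
open import Data.Fin as Fin using (Fin)
open import Data.Product using (Σ; _×_; _,_; proj₁; proj₂)
open import Data.Sum using (_⊎_; inj₁; inj₂)
open import Data.Empty using (⊥; ⊥-elim)
open import Function using (_∘_)
open import Relation.Nullary using (¬_; Dec; yes; no)
open import Relation.Binary.PropositionalEquality
open import Algebra.Properties.CommutativeSemigroup +-commutativeSemigroup
  using () renaming (interchange to +-interchange)
open import Algebra.Properties.CommutativeSemigroup *-commutativeSemigroup
  using () renaming (interchange to *-interchange)
open import Algebra.Properties.CommutativeSemigroup ℤP.+-commutativeSemigroup
  using () renaming (interchange to ℤ+-interchange)

sumℕ-cong : ∀ {n} {g h : Fin n → ℕ} → (∀ k → g k ≡ h k) → sumℕ g ≡ sumℕ h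
sumℕ-cong {zero}  eq = refl
sumℕ-cong {suc n} eq = cong₂ _+_ (eq Fin.zero) (sumℕ-cong (eq ∘ Fin.suc))

sumℕ-zero : ∀ n → sumℕ {n} (λ _ → 0) ≡ 0
sumℕ-zero zero    = refl
sumℕ-zero (suc n) = sumℕ-zero n

sumℕ-+ : ∀ {n} (g h : Fin n → ℕ) → sumℕ (λ k → g k + h k) ≡ sumℕ g + sumℕ h
sumℕ-+ {zero}  g h = refl
sumℕ-+ {suc n} g h =
  trans (cong (_+_ (g Fin.zero + h Fin.zero)) (sumℕ-+ (g ∘ Fin.suc) (h ∘ Fin.suc)))
        (+-interchange (g Fin.zero) (h Fin.zero) _ _)

sumℕ-*ˡ : ∀ {n} c (g : Fin n → ℕ) → sumℕ (λ k → c * g k) ≡ c * sumℕ g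
sumℕ-*ˡ {zero}  c g = sym (*-zeroʳ c)
sumℕ-*ˡ {suc n} c g =
  trans (cong (_+_ (c * g Fin.zero)) (sumℕ-*ˡ c (g ∘ Fin.suc))) (sym (*-distribˡ-+ c (g Fin.zero) _))

sumℕ-swap : ∀ {n m} (G : Fin n → Fin m → ℕ) →
  sumℕ (λ i → sumℕ (λ k → G i k)) ≡ sumℕ (λ k → sumℕ (λ i → G i k))
sumℕ-swap {zero}  {m} G = sym (sumℕ-zero m)
sumℕ-swap {suc n}     G =
  trans (cong (_+_ (sumℕ (G Fin.zero))) (sumℕ-swap (G ∘ Fin.suc)))
        (sym (sumℕ-+ (G Fin.zero) (λ k → sumℕ (λ i → G (Fin.suc i) k))))

sum-dotℕ : ∀ {n m} (w : Fin n → Fin m → ℕ) (b : Fin m → ℕ) →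
  sumℕ (λ i → dotℕ (w i) b) ≡ dotℕ (λ k → sumℕ (λ i → w i k)) b
sum-dotℕ w b = trans (sumℕ-swap (λ i k → w i k * b k)) (sumℕ-cong column)
  where
  column : ∀ k → sumℕ (λ i → w i k * b k) ≡ sumℕ (λ i → w i k) * b k
  column k = trans (sumℕ-cong (λ i → *-comm (w i k) (b k)))
                   (trans (sumℕ-*ˡ (b k) (λ i → w i k)) (*-comm (b k) _))

dotℕ-linear : ∀ {n} (v x y : Fin n → ℕ) c → dotℕ v (λ k → x k + c * y k) ≡ dotℕ v x + c * dotℕ v y
dotℕ-linear v x y c = begin
  sumℕ (λ k → v k * (x k + c * y k))        ≡⟨ sumℕ-cong (λ k → *-distribˡ-+ (v k) (x k) (c * y k)) ⟩
  sumℕ (λ k → v k * x k + v k * (c * y k))  ≡⟨ sumℕ-+ (λ k → v k * x k) (λ k → v k * (c * y k)) ⟩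
  dotℕ v x + sumℕ (λ k → v k * (c * y k))   ≡⟨ cong (_+_ (dotℕ v x)) (sumℕ-cong (λ k → x*[y*z]≡y*[x*z] (v k) c (y k))) ⟩
  dotℕ v x + sumℕ (λ k → c * (v k * y k))   ≡⟨ cong (_+_ (dotℕ v x)) (sumℕ-*ˡ c (λ k → v k * y k)) ⟩
  dotℕ v x + c * dotℕ v y                   ∎
  where
  open ≡-Reasoning
  x*[y*z]≡y*[x*z] : ∀ a b c → a * (b * c) ≡ b * (a * c)
  x*[y*z]≡y*[x*z] a b c = trans (sym (*-assoc a b c)) (trans (cong (_* c) (*-comm a b)) (*-assoc b a c))

dotℕ-zeroʳ : ∀ {n} (v : Fin n → ℕ) → dotℕ v (λ _ → 0) ≡ 0
dotℕ-zeroʳ {n} v = trans (sumℕ-cong (λ k → *-zeroʳ (v k))) (sumℕ-zero n)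

sumℤ-cong : ∀ {n} {g h : Fin n → ℤ} → (∀ k → g k ≡ h k) → sumℤ g ≡ sumℤ h
sumℤ-cong {zero}  eq = refl
sumℤ-cong {suc n} eq = cong₂ ℤ._+_ (eq Fin.zero) (sumℤ-cong (eq ∘ Fin.suc))

sumℤ-zero : ∀ n → sumℤ {n} (λ _ → + 0) ≡ + 0
sumℤ-zero zero    = refl
sumℤ-zero (suc n) = trans (ℤP.+-identityˡ _) (sumℤ-zero n)

sumℤ-+ : ∀ {n} (g h : Fin n → ℤ) → sumℤ (λ k → g k ℤ.+ h k) ≡ sumℤ g ℤ.+ sumℤ h
sumℤ-+ {zero}  g h = refl
sumℤ-+ {suc n} g h =
  trans (cong (ℤ._+_ (g Fin.zero ℤ.+ h Fin.zero)) (sumℤ-+ (g ∘ Fin.suc) (h ∘ Fin.suc)))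
        (ℤ+-interchange (g Fin.zero) (h Fin.zero) _ _)

sumℤ-pos : ∀ {n} (g : Fin n → ℕ) → sumℤ (λ k → + g k) ≡ + sumℕ g
sumℤ-pos {zero}  g = refl
sumℤ-pos {suc n} g = trans (cong (ℤ._+_ (+ g Fin.zero)) (sumℤ-pos (g ∘ Fin.suc))) (sym (ℤP.pos-+ (g Fin.zero) _))

sumℚ-cong : ∀ {n} {g h : Fin n → ℚ} → (∀ k → g k ≡ h k) → sumℚ g ≡ sumℚ h
sumℚ-cong {zero}  eq = refl
sumℚ-cong {suc n} eq = cong₂ ℚ._+_ (eq Fin.zero) (sumℚ-cong (eq ∘ Fin.suc))

sumFrom1ℤ-cong : ∀ s {g h : ℕ → ℤ} → (∀ l → g (suc l) ≡ h (suc l)) → sumFrom1ℤ s g ≡ sumFrom1ℤ s h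
sumFrom1ℤ-cong zero    eq = refl
sumFrom1ℤ-cong (suc s) eq = cong₂ ℤ._+_ (sumFrom1ℤ-cong s eq) (eq s)

sumFrom1ℤ-zero : ∀ s → sumFrom1ℤ s (λ _ → + 0) ≡ + 0
sumFrom1ℤ-zero zero    = refl
sumFrom1ℤ-zero (suc s) = trans (ℤP.+-identityʳ _) (sumFrom1ℤ-zero s)

sumFrom1ℤ-+ : ∀ s (g h : ℕ → ℤ) → sumFrom1ℤ s (λ ℓ → g ℓ ℤ.+ h ℓ) ≡ sumFrom1ℤ s g ℤ.+ sumFrom1ℤ s h
sumFrom1ℤ-+ zero    g h = refl
sumFrom1ℤ-+ (suc s) g h =
  trans (cong (ℤ._+ (g (suc s) ℤ.+ h (suc s))) (sumFrom1ℤ-+ s g h))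
        (ℤ+-interchange (sumFrom1ℤ s g) (sumFrom1ℤ s h) _ _)

sumFrom1ℤ-- : ∀ s (g h : ℕ → ℤ) → sumFrom1ℤ s (λ ℓ → g ℓ ℤ.- h ℓ) ≡ sumFrom1ℤ s g ℤ.- sumFrom1ℤ s h
sumFrom1ℤ-- zero    g h = refl
sumFrom1ℤ-- (suc s) g h =
  trans (cong (ℤ._+ (g (suc s) ℤ.- h (suc s))) (sumFrom1ℤ-- s g h))
        (regroup (sumFrom1ℤ s g) (sumFrom1ℤ s h) (g (suc s)) (h (suc s)))
  where
  regroup : ∀ (a b c d : ℤ) → (a ℤ.- b) ℤ.+ (c ℤ.- d) ≡ (a ℤ.+ c) ℤ.- (b ℤ.+ d)
  regroup = solve-∀

sumℤ-sumFrom1ℤ : ∀ {n} s (G : Fin n → ℕ → ℤ) →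
  sumℤ (λ i → sumFrom1ℤ s (G i)) ≡ sumFrom1ℤ s (λ ℓ → sumℤ (λ i → G i ℓ))
sumℤ-sumFrom1ℤ {n} zero    G = sumℤ-zero n
sumℤ-sumFrom1ℤ     (suc s) G =
  trans (sumℤ-+ (λ i → sumFrom1ℤ s (G i)) (λ i → G i (suc s)))
        (cong (ℤ._+ sumℤ (λ i → G i (suc s))) (sumℤ-sumFrom1ℤ s G))

-- Everything is reduced to the
-- unnormalised representation, in which m/(q'+1) is literally the pair (m, q').

toℚᵘ-/ : ∀ i q' → toℚᵘ (i ℚ./ suc q') ℚᵘ.≃ mkℚᵘ i q'
toℚᵘ-/ i q' = ℚP.toℚᵘ-fromℚᵘ (mkℚᵘ i q')

-- ⌊m/q⌋ is natural-number division.  The normal form of m/q is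
-- (m/g)/(q/g) with g = gcd m q, so this is the cancellation m*g/(q*g) = m/q.
floor-/ : ∀ m q .{{_ : NonZero q}} → floor (+ m ℚ./ q) ≡ + (m / q)
floor-/ m (suc q') with + m ℚ./ suc q' | ℚP.↥-/ (+ m) (suc q') | ℚP.↧-/ (+ m) (suc q')
... | mkℚ (+ N) D _ | num | den = trans (ℤP.*-identityˡ _) (cong +_ (sym cancel))
  where
  g : ℕ
  g = gcd m (suc q')
  num' : N * g ≡ m
  num' = ℤP.+-injective (trans (ℤP.pos-* N g) num)
  den' : suc D * g ≡ suc q'
  den' = ℤP.+-injective (trans (ℤP.pos-* (suc D) g) den)
  instance
    Dg≢0 : NonZero (suc D * g)
    Dg≢0 = subst NonZero (sym den') _
  cancel : m / suc q' ≡ N / suc D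
  cancel = begin
    m / suc q'               ≡⟨ /-congˡ (sym num') ⟩
    (N * g) / suc q'         ≡⟨ /-congʳ (sym den') ⟩
    (N * g) / (suc D * g)    ≡⟨ m*n/o*n≡m/o N g (suc D) ⟩
    N / suc D                ∎
    where open ≡-Reasoning
... | mkℚ -[1+ N ] D _ | num | den with gcd m (suc q') | den
...   | zero   | den0 with () ← trans (sym (*-zeroʳ (suc D))) (ℤP.+-injective (trans (ℤP.pos-* (suc D) 0) den0))
...   | suc g' | _    with () ← num

frac-/ : ∀ x q .{{_ : NonZero q}} → frac (divℚ x q) ≡ + (x % q) ℚ./ q
frac-/ x q@(suc q') = trans (cong (λ z → + x ℚ./ q ℚ.- z ℚ./ 1) (floor-/ x q)) (ℚP.toℚᵘ-injective (begin
  toℚᵘ (+ x ℚ./ q ℚ.+ ℚ.- (+ B ℚ./ 1))          ≈⟨ ℚP.toℚᵘ-homo-+ (+ x ℚ./ q) (ℚ.- (+ B ℚ./ 1)) ⟩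
  toℚᵘ (+ x ℚ./ q) ℚᵘ.+ toℚᵘ (ℚ.- (+ B ℚ./ 1))  ≈⟨ ℚᵘP.+-cong (toℚᵘ-/ (+ x) q') (ℚᵘP.≃-trans (ℚP.toℚᵘ-homo‿- (+ B ℚ./ 1)) (ℚᵘP.-‿cong (toℚᵘ-/ (+ B) 0))) ⟩
  mkℚᵘ (+ x) q' ℚᵘ.+ ℚᵘ.- mkℚᵘ (+ B) 0          ≈⟨ *≡* cross ⟩
  mkℚᵘ (+ R) q'                                 ≈⟨ ℚᵘP.≃-sym (toℚᵘ-/ (+ R) q') ⟩
  toℚᵘ (+ R ℚ./ q)                              ∎))
  where
  open ℚᵘP.≃-Reasoning
  R B : ℕ
  R = x % q
  B = x / q
  x≡R+Bq : + x ≡ + R ℤ.+ + B ℤ.* + q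
  x≡R+Bq = trans (cong +_ (m≡m%n+[m/n]*n x q)) (trans (ℤP.pos-+ R (B * q)) (cong (ℤ._+_ (+ R)) (ℤP.pos-* B q)))
  identity : ∀ (r b c : ℤ) → ((r ℤ.+ b ℤ.* c) ℤ.* + 1 ℤ.+ (ℤ.- b) ℤ.* c) ℤ.* c ≡ r ℤ.* (c ℤ.* + 1)
  identity = solve-∀
  cross : (+ x ℤ.* + 1 ℤ.+ (ℤ.- + B) ℤ.* + q) ℤ.* + q ≡ + R ℤ.* (+ q ℤ.* + 1)
  cross = trans (cong (λ z → (z ℤ.* + 1 ℤ.+ (ℤ.- + B) ℤ.* + q) ℤ.* + q) x≡R+Bq) (identity (+ R) (+ B) (+ q))

dot-/ : ∀ {n} (v r : Fin n → ℕ) q .{{_ : NonZero q}} →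
  dot v (λ k → + r k ℚ./ q) ≡ + dotℕ v r ℚ./ q
dot-/ {zero}  v r (suc q') = ℚP.toℚᵘ-injective (ℚᵘP.≃-sym (ℚᵘP.≃-trans (toℚᵘ-/ (+ 0) q') (*≡* refl)))
dot-/ {suc n} v r q@(suc q') =
  trans (cong (ℚ._+_ (toℚ (v Fin.zero) ℚ.* (+ r Fin.zero ℚ./ q))) (dot-/ (v ∘ Fin.suc) (r ∘ Fin.suc) q))
        (ℚP.toℚᵘ-injective (begin
    toℚᵘ (toℚ a ℚ.* (+ b ℚ./ q) ℚ.+ + S ℚ./ q)        ≈⟨ ℚP.toℚᵘ-homo-+ (toℚ a ℚ.* (+ b ℚ./ q)) (+ S ℚ./ q) ⟩
    toℚᵘ (toℚ a ℚ.* (+ b ℚ./ q)) ℚᵘ.+ toℚᵘ (+ S ℚ./ q) ≈⟨ ℚᵘP.+-cong (ℚᵘP.≃-trans (ℚP.toℚᵘ-homo-* (toℚ a) (+ b ℚ./ q)) (ℚᵘP.*-cong (toℚᵘ-/ (+ a) 0) (toℚᵘ-/ (+ b) q'))) (toℚᵘ-/ (+ S) q') ⟩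
    mkℚᵘ (+ a) 0 ℚᵘ.* mkℚᵘ (+ b) q' ℚᵘ.+ mkℚᵘ (+ S) q' ≈⟨ *≡* cross ⟩
    mkℚᵘ (+ (a * b + S)) q'                             ≈⟨ ℚᵘP.≃-sym (toℚᵘ-/ _ q') ⟩
    toℚᵘ (+ (a * b + S) ℚ./ q)                          ∎))
  where
  open ℚᵘP.≃-Reasoning
  a b S : ℕ
  a = v Fin.zero
  b = r Fin.zero
  S = dotℕ (v ∘ Fin.suc) (r ∘ Fin.suc)
  identity : ∀ (a b s c : ℤ) → ((a ℤ.* b) ℤ.* c ℤ.+ s ℤ.* (+ 1 ℤ.* c)) ℤ.* c ≡ (a ℤ.* b ℤ.+ s) ℤ.* ((+ 1 ℤ.* c) ℤ.* c)
  identity = solve-∀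
  ab+S : + (a * b + S) ≡ + a ℤ.* + b ℤ.+ + S
  ab+S = trans (ℤP.pos-+ (a * b) S) (cong (ℤ._+ + S) (ℤP.pos-* a b))
  cross : ((+ a ℤ.* + b) ℤ.* + q ℤ.+ + S ℤ.* (+ 1 ℤ.* + q)) ℤ.* + q ≡ + (a * b + S) ℤ.* ((+ 1 ℤ.* + q) ℤ.* + q)
  cross = trans (identity (+ a) (+ b) (+ S) (+ q)) (cong (ℤ._* ((+ 1 ℤ.* + q) ℤ.* + q)) (sym ab+S))

0≤/ : ∀ m q .{{_ : NonZero q}} → ℚ.0ℚ ℚ.≤ + m ℚ./ q
0≤/ m (suc q') = ℚP.toℚᵘ-cancel-≤ (ℚᵘP.≤-respʳ-≃ (ℚᵘP.≃-sym (toℚᵘ-/ (+ m) q'))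
  (*≤* (subst (+ 0 ℤ.≤_) (sym (ℤP.*-identityʳ (+ m))) (ℤ.+≤+ z≤n))))

/<1 : ∀ m q .{{_ : NonZero q}} → m < q → + m ℚ./ q ℚ.< ℚ.1ℚ
/<1 m (suc q') m<q = ℚP.toℚᵘ-cancel-< (ℚᵘP.<-respˡ-≃ (ℚᵘP.≃-sym (toℚᵘ-/ (+ m) q'))
  (*<* (subst₂ ℤ._<_ (sym (ℤP.*-identityʳ (+ m))) (sym (ℤP.*-identityˡ (+ suc q'))) (ℤ.+<+ m<q))))

1≤/ : ∀ m q .{{_ : NonZero q}} → q ≤ m → ℚ.1ℚ ℚ.≤ + m ℚ./ q
1≤/ m (suc q') q≤m = ℚP.toℚᵘ-cancel-≤ (ℚᵘP.≤-respʳ-≃ (ℚᵘP.≃-sym (toℚᵘ-/ (+ m) q'))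
  (*≤* (subst₂ ℤ._≤_ (sym (ℤP.*-identityˡ (+ suc q'))) (sym (ℤP.*-identityʳ (+ m))) (ℤ.+≤+ q≤m))))

𝟙[_∣_] : ℕ → ℕ → ℕ
𝟙[ q ∣ n ] with q ∣? n
... | yes _ = 1
... | no  _ = 0

/-suc : ∀ N q .{{_ : NonZero q}} → suc N / q ≡ N / q + 𝟙[ q ∣ suc N ]
/-suc N q = by-last-digit (m≤n⇒m<n∨m≡n (m%n<n N q))
  where
  R B : ℕ
  R = N % q
  B = N / q
  N+1≡R+1+Bq : suc N ≡ suc R + B * q
  N+1≡R+1+Bq = cong suc (m≡m%n+[m/n]*n N q)
  N+1≡[B+1]q : suc R ≡ q → suc N ≡ suc B * q
  N+1≡[B+1]q R+1≡q = trans N+1≡R+1+Bq (cong (_+ B * q) R+1≡q)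
  by-last-digit : suc R < q ⊎ suc R ≡ q → suc N / q ≡ B + 𝟙[ q ∣ suc N ]
  by-last-digit (inj₁ R+1<q) with q ∣? suc N
  ... | yes q∣N+1 = ⊥-elim (0≢1+n (begin
    0                        ≡⟨ n∣m⇒m%n≡0 (suc N) q q∣N+1 ⟨
    suc N % q                ≡⟨ %-congˡ N+1≡R+1+Bq ⟩
    (suc R + B * q) % q      ≡⟨ [m+kn]%n≡m%n (suc R) B q ⟩
    suc R % q                ≡⟨ m<n⇒m%n≡m R+1<q ⟩
    suc R                    ∎))
    where open ≡-Reasoning
  ... | no  _ = begin
    suc N / q                ≡⟨ /-congˡ N+1≡R+1+Bq ⟩
    (suc R + B * q) / q      ≡⟨ +-distrib-/-∣ʳ (suc R) (n∣m*n B) ⟩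
    suc R / q + B * q / q    ≡⟨ cong₂ _+_ (m<n⇒m/n≡0 R+1<q) (m*n/n≡m B q) ⟩
    B                        ≡⟨ +-identityʳ B ⟨
    B + 0                    ∎
    where open ≡-Reasoning
  by-last-digit (inj₂ R+1≡q) with q ∣? suc N
  ... | yes _     = trans (/-congˡ (N+1≡[B+1]q R+1≡q)) (trans (m*n/n≡m (suc B) q) (+-comm 1 B))
  ... | no  q∤N+1 = ⊥-elim (q∤N+1 (divides (suc B) (N+1≡[B+1]q R+1≡q)))

last-satisfying : (P : ℕ → Set) → (∀ m → Dec (P m)) → P 0 → ∀ s → ¬ P s →
  Σ ℕ λ m → m < s × P m × (∀ j → m < j → j ≤ s → ¬ P j)
last-satisfying P P? P0 zero    ¬Ps = ⊥-elim (¬Ps P0)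
last-satisfying P P? P0 (suc s) ¬Ps with P? s
... | yes Ps  = s , ≤-refl , Ps , λ j s<j j≤s+1 → subst (¬_ ∘ P) (≤-antisym s<j j≤s+1) ¬Ps
... | no  ¬Ps' with last-satisfying P P? P0 s ¬Ps'
...   | m , m<s , Pm , after-m = m , m<n⇒m<1+n m<s , Pm , after-m'
  where
  after-m' : ∀ j → m < j → j ≤ suc s → ¬ P j
  after-m' j m<j j≤s+1 with m≤n⇒m<n∨m≡n j≤s+1
  ... | inj₁ j<s+1 = after-m j m<j (≤-pred j<s+1)
  ... | inj₂ j≡s+1 = subst (¬_ ∘ P) (sym j≡s+1) ¬Ps

module Digits (p : ℕ) .{{_ : NonZero p}} where

  p^≢0 : ∀ ℓ → NonZero (p ^ ℓ)
  p^≢0 ℓ = m^n≢0 p ℓ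

  infixl 7 _%p^_ _/p^_
  _%p^_ _/p^_ : ℕ → ℕ → ℕ
  x %p^ ℓ = (x % p ^ ℓ) {{p^≢0 ℓ}}
  x /p^ ℓ = (x / p ^ ℓ) {{p^≢0 ℓ}}

  digits : ∀ x ℓ → x ≡ x %p^ ℓ + p ^ ℓ * (x /p^ ℓ)
  digits x ℓ = trans (m≡m%n+[m/n]*n x (p ^ ℓ) {{p^≢0 ℓ}}) (cong (_+_ (x %p^ ℓ)) (*-comm (x /p^ ℓ) (p ^ ℓ)))

  %p^<p^ : ∀ x ℓ → x %p^ ℓ < p ^ ℓ
  %p^<p^ x ℓ = m%n<n x (p ^ ℓ) {{p^≢0 ℓ}}

  %p^-split : ∀ x m l → x %p^ (m + l) ≡ x %p^ m + p ^ m * (x /p^ m %p^ l)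
  %p^-split x m l = begin
    x %p^ (m + l)                                     ≡⟨ %-congʳ {{p^≢0 (m + l)}} {{q≢0}} p^[m+l]≡q ⟩
    X                                                 ≡⟨ m≡m%n+[m/n]*n X (p ^ m) {{p^≢0 m}} ⟩
    (X % p ^ m) {{p^≢0 m}} + (X / p ^ m) {{p^≢0 m}} * p ^ m
      ≡⟨ cong₂ _+_ (m∣n⇒o%n%m≡o%m (p ^ m) q x {{p^≢0 m}} {{q≢0}} (n∣m*n (p ^ l)))
                   (cong (_* p ^ m) (m%[n*o]/o≡m/o%n x (p ^ l) (p ^ m) {{p^≢0 l}} {{p^≢0 m}} {{q≢0}})) ⟩
    x %p^ m + x /p^ m %p^ l * p ^ m                   ≡⟨ cong (_+_ (x %p^ m)) (*-comm (x /p^ m %p^ l) (p ^ m)) ⟩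
    x %p^ m + p ^ m * (x /p^ m %p^ l)                 ∎
    where
    open ≡-Reasoning
    q : ℕ
    q = p ^ l * p ^ m
    q≢0 : NonZero q
    q≢0 = m*n≢0 (p ^ l) (p ^ m) {{p^≢0 l}} {{p^≢0 m}}
    p^[m+l]≡q : p ^ (m + l) ≡ q
    p^[m+l]≡q = trans (^-distribˡ-+-* p m l) (*-comm (p ^ m) (p ^ l))
    X : ℕ
    X = (x % q) {{q≢0}}

  dot-/p^ : ∀ {n} (v a : Fin n → ℕ) ℓ →
    dotℕ v a /p^ ℓ ≡ dotℕ v (λ k → a k /p^ ℓ) + dotℕ v (λ k → a k %p^ ℓ) /p^ ℓ
  dot-/p^ v a ℓ = begin
    dotℕ v a /p^ ℓ                      ≡⟨ /-congˡ {{p^≢0 ℓ}} v·a≡low+q*high ⟩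
    ((low + q * high) / q) {{p^≢0 ℓ}}   ≡⟨ +-distrib-/-∣ʳ low {{p^≢0 ℓ}} (m∣m*n high) ⟩
    low /p^ ℓ + (q * high / q) {{p^≢0 ℓ}} ≡⟨ cong (_+_ (low /p^ ℓ)) (trans (/-congˡ {{p^≢0 ℓ}} (*-comm q high)) (m*n/n≡m high q {{p^≢0 ℓ}})) ⟩
    low /p^ ℓ + high                    ≡⟨ +-comm (low /p^ ℓ) high ⟩
    high + low /p^ ℓ                    ∎
    where
    open ≡-Reasoning
    q low high : ℕ
    q = p ^ ℓ
    low = dotℕ v (λ k → a k %p^ ℓ)
    high = dotℕ v (λ k → a k /p^ ℓ)
    v·a≡low+q*high : dotℕ v a ≡ low + q * high
    v·a≡low+q*high = trans (sumℕ-cong (λ k → cong (v k *_) (digits (a k) ℓ)))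
                           (dotℕ-linear v (λ k → a k %p^ ℓ) (λ k → a k /p^ ℓ) q)

  frac-/p^ : ∀ x ℓ → frac (divℚ x (p ^ ℓ)) ≡ (+ (x %p^ ℓ) ℚ./ p ^ ℓ) {{p^≢0 ℓ}}
  frac-/p^ x ℓ = frac-/ x (p ^ ℓ) {{p^≢0 ℓ}}

  dot-frac-/p^ : ∀ {n} (v x : Fin n → ℕ) ℓ →
    dot v (λ k → frac (divℚ (x k) (p ^ ℓ))) ≡ (+ dotℕ v (λ k → x k %p^ ℓ) ℚ./ p ^ ℓ) {{p^≢0 ℓ}}
  dot-frac-/p^ v x ℓ = trans (sumℚ-cong (λ k → cong (toℚ (v k) ℚ.*_) (frac-/p^ (x k) ℓ)))
                             (dot-/ v (λ k → x k %p^ ℓ) (p ^ ℓ) {{p^≢0 ℓ}})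

vpFuel-exact : ∀ p .{{_ : NonTrivial p}} fuel n → 0 < n → n ≤ fuel →
  p ^ vpFuel fuel p n ∣ n × ¬ (p ^ suc (vpFuel fuel p n) ∣ n)
vpFuel-exact p@(suc (suc _)) (suc fuel) (suc m) _ (s≤s m≤fuel) with p ∣? suc m
... | no  p∤n = 1∣ suc m , λ p^1∣n → p∤n (subst (_∣ suc m) (*-identityʳ p) p^1∣n)
... | yes p∣n = p^[v+1]∣n , p^[v+2]∤n
  where
  n/p : ℕ
  n/p = suc m / p
  p*n/p≡n : p * n/p ≡ suc m
  p*n/p≡n = m*[n/m]≡n p∣n
  n/p≤fuel : n/p ≤ fuel
  n/p≤fuel = ≤-pred (≤-trans (m/n<m (suc m) p (s≤s (s≤s z≤n))) (s≤s m≤fuel))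
  v : ℕ
  v = vpFuel fuel p n/p
  IH : p ^ v ∣ n/p × ¬ (p ^ suc v ∣ n/p)
  IH = vpFuel-exact p fuel n/p (m≥n⇒m/n>0 (∣⇒≤ p∣n)) n/p≤fuel
  p^[v+1]∣n : p ^ suc v ∣ suc m
  p^[v+1]∣n = subst (p ^ suc v ∣_) p*n/p≡n (*-monoʳ-∣ p (proj₁ IH))
  p^[v+2]∤n : ¬ (p ^ suc (suc v) ∣ suc m)
  p^[v+2]∤n h = proj₂ IH (*-cancelˡ-∣ p (subst (p ^ suc (suc v) ∣_) (sym p*n/p≡n) h))

module Valuation (p : ℕ) (p-prime : Prime p) where

  private instance
    p-nontrivial : NonTrivial p
    p-nontrivial = prime⇒nonTrivial p-prime
    p≢0 : NonZero p
    p≢0 = nonTrivial⇒nonZero p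

  open Digits p

  p^∣p^ : ∀ {a b} → a ≤ b → p ^ a ∣ p ^ b
  p^∣p^ {a} {b} a≤b = divides (p ^ (b ∸ a)) (begin
    p ^ b               ≡⟨ cong (p ^_) (m+[n∸m]≡n a≤b) ⟨
    p ^ (a + (b ∸ a))   ≡⟨ ^-distribˡ-+-* p a (b ∸ a) ⟩
    p ^ a * p ^ (b ∸ a) ≡⟨ *-comm (p ^ a) _ ⟩
    p ^ (b ∸ a) * p ^ a ∎)
    where open ≡-Reasoning

  vp-exact : ∀ n → 0 < n → p ^ vp p n ∣ n × ¬ (p ^ suc (vp p n) ∣ n)
  vp-exact n 0<n = vpFuel-exact p n n 0<n ≤-refl

  ≤vp⇒p^∣ : ∀ {ℓ n} → 0 < n → ℓ ≤ vp p n → p ^ ℓ ∣ n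
  ≤vp⇒p^∣ 0<n ℓ≤v = ∣-trans (p^∣p^ ℓ≤v) (proj₁ (vp-exact _ 0<n))

  p^∣⇒≤vp : ∀ {ℓ n} → 0 < n → p ^ ℓ ∣ n → ℓ ≤ vp p n
  p^∣⇒≤vp {ℓ} {n} 0<n p^ℓ∣n = ≮⇒≥ (λ v<ℓ → proj₂ (vp-exact n 0<n) (∣-trans (p^∣p^ v<ℓ) p^ℓ∣n))

  p^∤⇒vp≤ : ∀ {L n} → 0 < n → ¬ (p ^ suc L ∣ n) → vp p n ≤ L
  p^∤⇒vp≤ 0<n p^[L+1]∤n = ≮⇒≥ (λ L<v → p^[L+1]∤n (≤vp⇒p^∣ 0<n L<v))

  vp-unique : ∀ {n k} → 0 < n → p ^ k ∣ n → ¬ (p ^ suc k ∣ n) → vp p n ≡ k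
  vp-unique 0<n p^k∣n p^[k+1]∤n = ≤-antisym (p^∤⇒vp≤ 0<n p^[k+1]∤n) (p^∣⇒≤vp 0<n p^k∣n)

  -- v_p is additive; this is where primality of p enters (Euclid's lemma).
  vp-* : ∀ x y → 0 < x → 0 < y → vp p (x * y) ≡ vp p x + vp p y
  vp-* x y 0<x 0<y = vp-unique (*-mono-< 0<x 0<y) p^[a+b]∣xy p^[a+b+1]∤xy
    where
    a b x' y' : ℕ
    a = vp p x
    b = vp p y
    x' = quotient (proj₁ (vp-exact x 0<x))
    y' = quotient (proj₁ (vp-exact y 0<y))
    x≡x'p^a : x ≡ x' * p ^ a
    x≡x'p^a = m∣n⇒n≡quotient*m (proj₁ (vp-exact x 0<x))
    y≡y'p^b : y ≡ y' * p ^ b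
    y≡y'p^b = m∣n⇒n≡quotient*m (proj₁ (vp-exact y 0<y))
    xy≡x'y'p^[a+b] : x * y ≡ (x' * y') * p ^ (a + b)
    xy≡x'y'p^[a+b] = begin
      x * y                       ≡⟨ cong₂ _*_ x≡x'p^a y≡y'p^b ⟩
      (x' * p ^ a) * (y' * p ^ b) ≡⟨ *-interchange x' (p ^ a) y' (p ^ b) ⟩
      (x' * y') * (p ^ a * p ^ b) ≡⟨ cong (_*_ (x' * y')) (^-distribˡ-+-* p a b) ⟨
      (x' * y') * p ^ (a + b)     ∎
      where open ≡-Reasoning
    p^[a+b]∣xy : p ^ (a + b) ∣ x * y
    p^[a+b]∣xy = divides (x' * y') xy≡x'y'p^[a+b]
    p∤x' : ¬ (p ∣ x')
    p∤x' p∣x' = proj₂ (vp-exact x 0<x) (subst (p ^ suc a ∣_) (sym x≡x'p^a) (*-monoˡ-∣ (p ^ a) p∣x'))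
    p∤y' : ¬ (p ∣ y')
    p∤y' p∣y' = proj₂ (vp-exact y 0<y) (subst (p ^ suc b ∣_) (sym y≡y'p^b) (*-monoˡ-∣ (p ^ b) p∣y'))
    p^[a+b+1]∤xy : ¬ (p ^ suc (a + b) ∣ x * y)
    p^[a+b+1]∤xy h with euclidsLemma x' y' p-prime
      (*-cancelʳ-∣ (p ^ (a + b)) {{p^≢0 (a + b)}} (subst (p * p ^ (a + b) ∣_) xy≡x'y'p^[a+b] h))
    ... | inj₁ p∣x' = p∤x' p∣x'
    ... | inj₂ p∣y' = p∤y' p∣y'

  vp-1 : vp p 1 ≡ 0
  vp-1 = vp-unique (s≤s z≤n) (1∣ 1) (λ p∣1 → <⇒≱ (nonTrivial⇒n>1 p) (∣⇒≤ (subst (_∣ 1) (*-identityʳ p) p∣1)))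

  vp-bound : ∀ L n → 0 < n → n < p ^ suc L → vp p n ≤ L
  vp-bound L n 0<n n<p^[L+1] = p^∤⇒vp≤ 0<n (λ p^[L+1]∣n → <⇒≱ n<p^[L+1] (∣⇒≤ {{>-nonZero 0<n}} p^[L+1]∣n))

  count-powers : ∀ L n → 0 < n → sumFrom1ℤ L (λ ℓ → + 𝟙[ p ^ ℓ ∣ n ]) ≡ + (L ⊓ vp p n)
  count-powers zero    n 0<n = refl
  count-powers (suc L) n 0<n =
    trans (cong (ℤ._+ + 𝟙[ p ^ suc L ∣ n ]) (count-powers L n 0<n))
          (trans (sym (ℤP.pos-+ (L ⊓ vp p n) _)) (cong +_ step))
    where
    step : L ⊓ vp p n + 𝟙[ p ^ suc L ∣ n ] ≡ suc L ⊓ vp p n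
    step with p ^ suc L ∣? n
    ... | yes p^[L+1]∣n = trans (cong (_+ 1) (m≤n⇒m⊓n≡m (≤-trans (n≤1+n L) L+1≤v)))
                                (trans (+-comm L 1) (sym (m≤n⇒m⊓n≡m L+1≤v)))
      where
      L+1≤v : suc L ≤ vp p n
      L+1≤v = p^∣⇒≤vp 0<n p^[L+1]∣n
    ... | no  p^[L+1]∤n = trans (+-identityʳ _) (trans (m≥n⇒m⊓n≡n v≤L) (sym (m≥n⇒m⊓n≡n (≤-trans v≤L (n≤1+n L)))))
      where
      v≤L : vp p n ≤ L
      v≤L = p^∤⇒vp≤ 0<n p^[L+1]∤n

  legendre : ∀ L N → N < p ^ suc L → + vp p (N !) ≡ sumFrom1ℤ L (λ ℓ → + (N /p^ ℓ))
  legendre L zero _ = begin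
    + vp p 1                           ≡⟨ cong +_ vp-1 ⟩
    + 0                                ≡⟨ sumFrom1ℤ-zero L ⟨
    sumFrom1ℤ L (λ _ → + 0)            ≡⟨ sumFrom1ℤ-cong L (λ l → cong +_ (0/n≡0 (p ^ suc l) {{p^≢0 (suc l)}})) ⟨
    sumFrom1ℤ L (λ ℓ → + (0 /p^ ℓ))    ∎
    where open ≡-Reasoning
  legendre L (suc N) N+1<p^[L+1] = begin
    + vp p (suc N * N !)                                            ≡⟨ cong +_ (vp-* (suc N) (N !) (s≤s z≤n) (>-nonZero⁻¹ (N !) {{N !≢0}})) ⟩
    + (vp p (suc N) + vp p (N !))                                   ≡⟨ ℤP.pos-+ (vp p (suc N)) (vp p (N !)) ⟩
    + vp p (suc N) ℤ.+ + vp p (N !)                                 ≡⟨ cong₂ ℤ._+_ vp[N+1] (legendre L N (<-trans (n<1+n N) N+1<p^[L+1])) ⟩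
    sumFrom1ℤ L (λ ℓ → + 𝟙[ p ^ ℓ ∣ suc N ]) ℤ.+ sumFrom1ℤ L (λ ℓ → + (N /p^ ℓ))
                                                                    ≡⟨ sumFrom1ℤ-+ L _ _ ⟨
    sumFrom1ℤ L (λ ℓ → + 𝟙[ p ^ ℓ ∣ suc N ] ℤ.+ + (N /p^ ℓ))        ≡⟨ sumFrom1ℤ-cong L (λ l → sym (next-term (suc l))) ⟩
    sumFrom1ℤ L (λ ℓ → + (suc N /p^ ℓ))                             ∎
    where
    open ≡-Reasoning
    vp[N+1] : + vp p (suc N) ≡ sumFrom1ℤ L (λ ℓ → + 𝟙[ p ^ ℓ ∣ suc N ])
    vp[N+1] = sym (trans (count-powers L (suc N) (s≤s z≤n))
                         (cong +_ (m≥n⇒m⊓n≡n (vp-bound L (suc N) (s≤s z≤n) N+1<p^[L+1]))))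
    next-term : ∀ ℓ → + (suc N /p^ ℓ) ≡ + 𝟙[ p ^ ℓ ∣ suc N ] ℤ.+ + (N /p^ ℓ)
    next-term ℓ = trans (cong +_ (trans (/-suc N (p ^ ℓ) {{p^≢0 ℓ}}) (+-comm (N /p^ ℓ) _))) (ℤP.pos-+ _ (N /p^ ℓ))

module Bound {d q₁ q₂ : ℕ} (e : Fin q₁ → Fin d → ℕ) (f : Fin q₂ → Fin d → ℕ)
             (p : ℕ) .{{_ : NonTrivial p}} where

  open Setup e f

  private instance
    p≢0 : NonZero p
    p≢0 = nonTrivial⇒nonZero p

  open Digits p

  SomeAtLeastOne : (Fin d → ℚ) → Set
  SomeAtLeastOne x = (Σ (Fin q₁) λ i → ℚ.1ℚ ℚ.≤ dot (e i) x) ⊎ (Σ (Fin q₂) λ j → ℚ.1ℚ ℚ.≤ dot (f j) x)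

  -- v behaves like one of e_1,…,e_{q₁},f_1,…,f_{q₂} with respect to that clause.
  Among : (Fin d → ℕ) → Set
  Among v = ∀ x → ℚ.1ℚ ℚ.≤ dot v x → SomeAtLeastOne x

  lowDot : (Fin d → ℕ) → (Fin d → ℕ) → ℕ → ℕ
  lowDot v a m = dotℕ v (λ k → a k %p^ m)

  frac-/p^-∈𝒟 : ∀ v → Among v → ∀ n ℓ → p ^ ℓ ≤ lowDot v n ℓ → InD (fracDiv p ℓ n)
  frac-/p^-∈𝒟 v among n ℓ p^ℓ≤v·n = record
    { nonneg   = λ k → subst (ℚ.0ℚ ℚ.≤_) (sym (frac-/p^ (n k) ℓ)) (0≤/ (n k %p^ ℓ) (p ^ ℓ) {{p^≢0 ℓ}})
    ; belowOne = λ k → subst (ℚ._< ℚ.1ℚ) (sym (frac-/p^ (n k) ℓ)) (/<1 (n k %p^ ℓ) (p ^ ℓ) {{p^≢0 ℓ}} (%p^<p^ (n k) ℓ))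
    ; someGe1  = among (fracDiv p ℓ n) (subst (ℚ.1ℚ ℚ.≤_) (sym (dot-frac-/p^ v n ℓ)) (1≤/ (lowDot v n ℓ) (p ^ ℓ) {{p^≢0 ℓ}} p^ℓ≤v·n))
    }

  -- If lowDot is below p^(m+1) at level m but at least p^(m+ℓ+1) at level
  -- m + ℓ, the digits of a in positions m,…,m+ℓ-1 alone give v-weight ≥ p^ℓ.
  -- (The increase p^m·G must exceed p^(m+ℓ+1) − p^(m+1) ≥ p^(m+ℓ) since p ≥ 2.)
  crossing : ∀ v a m ℓ → 1 ≤ ℓ → lowDot v a m < p ^ suc m → p ^ suc (m + ℓ) ≤ lowDot v a (m + ℓ) →
    p ^ ℓ ≤ lowDot v (λ k → a k /p^ m) ℓ
  crossing v a m ℓ 1≤ℓ below above = ≮⇒≥ (λ G<p^ℓ → <⇒≱ (stays-below G<p^ℓ) above)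
    where
    G X : ℕ
    G = lowDot v (λ k → a k /p^ m) ℓ
    X = p ^ (m + ℓ)
    split : lowDot v a (m + ℓ) ≡ lowDot v a m + p ^ m * G
    split = trans (sumℕ-cong (λ k → cong (v k *_) (%p^-split (a k) m ℓ)))
                  (dotℕ-linear v (λ k → a k %p^ m) (λ k → a k /p^ m %p^ ℓ) (p ^ m))
    stays-below : G < p ^ ℓ → lowDot v a (m + ℓ) < p ^ suc (m + ℓ)
    stays-below G<p^ℓ = begin-strict
      lowDot v a (m + ℓ)        ≡⟨ split ⟩
      lowDot v a m + p ^ m * G  <⟨ +-mono-<-≤ (<-≤-trans below (^-monoʳ-≤ p (m<m+n m 1≤ℓ))) p^mG≤X ⟩
      X + X                     ≡⟨ cong (_+_ X) (+-identityʳ X) ⟨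
      2 * X                     ≤⟨ *-monoˡ-≤ X (nonTrivial⇒n>1 p) ⟩
      p * X                     ∎
      where
      open ≤-Reasoning
      p^mG≤X : p ^ m * G ≤ X
      p^mG≤X = subst (p ^ m * G ≤_) (sym (^-distribˡ-+-* p m ℓ)) (*-monoʳ-≤ (p ^ m) (<⇒≤ G<p^ℓ))

  upper-digits-∈𝒩 : ∀ v → Among v → ∀ a m t → 1 ≤ t → (∀ k → a k < p ^ (m + t)) →
    lowDot v a m < p ^ suc m →
    (∀ ℓ → 1 ≤ ℓ → ℓ ≤ t → p ^ suc (m + ℓ) ≤ lowDot v a (m + ℓ)) →
    InN p (λ k → a k /p^ m) t
  upper-digits-∈𝒩 v among a m t 1≤t a<p^[m+t] below above = record
    { t≥1     = 1≤t
    ; bounded = λ k → m<n*o⇒m/o<n {{p^≢0 m}} (subst (a k <_) p^[m+t]≡p^t*p^m (a<p^[m+t] k))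
    ; allD    = λ ℓ 1≤ℓ ℓ≤t → frac-/p^-∈𝒟 v among (λ k → a k /p^ m) ℓ (crossing v a m ℓ 1≤ℓ below (above ℓ 1≤ℓ ℓ≤t))
    }
    where
    p^[m+t]≡p^t*p^m : p ^ (m + t) ≡ p ^ t * p ^ m
    p^[m+t]≡p^t*p^m = trans (^-distribˡ-+-* p m t) (*-comm (p ^ m) (p ^ t))

  -- Otherwise lowDot v a would start below p at level 0 and
  -- end at v·a ≥ p^(s+1) at level s; at its last crossing m the digits of a
  -- above m give (n, s − m) ∈ 𝒩 with a = (a mod p^m) + p^m n, which Ψ_s(𝒩) forbids.
  dot-bound : ∀ v → Among v → ∀ s a → InΨ p s a → dotℕ v a < p ^ suc s
  dot-bound v among s a a∈Ψ = ≰⇒> λ p^[s+1]≤v·a →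
    let (m , m<s , below , after) = last-satisfying Below (λ m → lowDot v a m <? p ^ suc m) below-at-0 s
                                                    (λ below-at-s → <⇒≱ (subst (_< p ^ suc s) lowDot-at-s below-at-s) p^[s+1]≤v·a)
    in last-crossing-excluded m m<s below (λ ℓ 1≤ℓ ℓ≤s∸m → ≮⇒≥ (after (m + ℓ) (m<m+n m 1≤ℓ)
         (subst (m + ℓ ≤_) (m+[n∸m]≡n (<⇒≤ m<s)) (+-monoʳ-≤ m ℓ≤s∸m))))
    where
    Below : ℕ → Set
    Below m = lowDot v a m < p ^ suc m
    below-at-0 : Below 0
    below-at-0 = subst (_< p ^ 1) (sym (trans (sumℕ-cong (λ k → cong (v k *_) (n%1≡0 (a k)))) (dotℕ-zeroʳ v)))
                       (m^n>0 p 1)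
    lowDot-at-s : lowDot v a s ≡ dotℕ v a
    lowDot-at-s = sumℕ-cong (λ k → cong (v k *_) (m<n⇒m%n≡m {{p^≢0 s}} (InΨ.bounded a∈Ψ k)))
    last-crossing-excluded : ∀ m → m < s → Below m →
      (∀ ℓ → 1 ≤ ℓ → ℓ ≤ s ∸ m → p ^ suc (m + ℓ) ≤ lowDot v a (m + ℓ)) → ⊥
    last-crossing-excluded m m<s below above =
      InΨ.avoids a∈Ψ (λ k → a k /p^ m) (s ∸ m) upper∈𝒩 (m∸n≤m s m) (λ k → a k %p^ m) lower-bound descendant
      where
      m+[s∸m]≡s : m + (s ∸ m) ≡ s
      m+[s∸m]≡s = m+[n∸m]≡n (<⇒≤ m<s)
      s∸[s∸m]≡m : s ∸ (s ∸ m) ≡ m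
      s∸[s∸m]≡m = m∸[m∸n]≡n (<⇒≤ m<s)
      upper∈𝒩 : InN p (λ k → a k /p^ m) (s ∸ m)
      upper∈𝒩 = upper-digits-∈𝒩 v among a m (s ∸ m) (m<n⇒0<n∸m m<s)
                  (λ k → subst (λ u → a k < p ^ u) (sym m+[s∸m]≡s) (InΨ.bounded a∈Ψ k)) below above
      lower-bound : ∀ k → a k %p^ m < p ^ (s ∸ (s ∸ m))
      lower-bound k = subst (λ u → a k %p^ m < p ^ u) (sym s∸[s∸m]≡m) (%p^<p^ (a k) m)
      descendant : ∀ k → a k ≡ a k %p^ m + p ^ (s ∸ (s ∸ m)) * (a k /p^ m)
      descendant k = subst (λ u → a k ≡ a k %p^ m + p ^ u * (a k /p^ m)) (sym s∸[s∸m]≡m) (digits (a k) m)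

-- At a single level ℓ the contributions of ⌊a/p^ℓ⌋ cancel because |e| = |f|,
-- leaving Δ({a/p^ℓ}).
module Levels {d q₁ q₂ : ℕ} (e : Fin q₁ → Fin d → ℕ) (f : Fin q₂ → Fin d → ℕ)
              (|e|≡|f| : ∀ k → sumℕ (λ i → e i k) ≡ sumℕ (λ j → f j k))
              (p : ℕ) .{{_ : NonZero p}} where

  open Setup e f
  open Digits p

  balanced : ∀ b → sumℕ (λ i → dotℕ (e i) b) ≡ sumℕ (λ j → dotℕ (f j) b)
  balanced b = trans (sum-dotℕ e b)
                     (trans (sumℕ-cong (λ k → cong (_* b k) (|e|≡|f| k))) (sym (sum-dotℕ f b)))

  floor-dot-frac : ∀ v a ℓ → floor (dot v (fracDiv p ℓ a)) ≡ + (dotℕ v (λ k → a k %p^ ℓ) /p^ ℓ)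
  floor-dot-frac v a ℓ = trans (cong floor (dot-frac-/p^ v a ℓ)) (floor-/ _ (p ^ ℓ) {{p^≢0 ℓ}})

  split-floors : ∀ {n} (w : Fin n → Fin d → ℕ) a ℓ →
    sumℤ (λ i → + (dotℕ (w i) a /p^ ℓ))
      ≡ + sumℕ (λ i → dotℕ (w i) (λ k → a k /p^ ℓ)) ℤ.+ sumℤ (λ i → floor (dot (w i) (fracDiv p ℓ a)))
  split-floors {n} w a ℓ = begin
    sumℤ (λ i → + (dotℕ (w i) a /p^ ℓ))              ≡⟨ sumℤ-cong (λ i → trans (cong +_ (dot-/p^ (w i) a ℓ)) (ℤP.pos-+ (high i) (rest i))) ⟩
    sumℤ (λ i → + high i ℤ.+ + rest i)               ≡⟨ sumℤ-+ (λ i → + high i) (λ i → + rest i) ⟩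
    sumℤ (λ i → + high i) ℤ.+ sumℤ (λ i → + rest i)  ≡⟨ cong₂ ℤ._+_ (sumℤ-pos high) (sumℤ-cong (λ i → sym (floor-dot-frac (w i) a ℓ))) ⟩
    + sumℕ high ℤ.+ sumℤ (λ i → floor (dot (w i) (fracDiv p ℓ a))) ∎
    where
    open ≡-Reasoning
    high rest : Fin n → ℕ
    high i = dotℕ (w i) (λ k → a k /p^ ℓ)
    rest i = dotℕ (w i) (λ k → a k %p^ ℓ) /p^ ℓ

  level-identity : ∀ a ℓ →
    sumℤ (λ i → + (dotℕ (e i) a /p^ ℓ)) ℤ.- sumℤ (λ j → + (dotℕ (f j) a /p^ ℓ)) ≡ Δ (fracDiv p ℓ a)
  level-identity a ℓ = begin
    sumℤ (λ i → + (dotℕ (e i) a /p^ ℓ)) ℤ.- sumℤ (λ j → + (dotℕ (f j) a /p^ ℓ))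
      ≡⟨ cong₂ ℤ._-_ (split-floors e a ℓ) (split-floors f a ℓ) ⟩
    (+ high e ℤ.+ Fe) ℤ.- (+ high f ℤ.+ Ff)  ≡⟨ cong (λ h → (+ high e ℤ.+ Fe) ℤ.- (+ h ℤ.+ Ff)) (balanced (λ k → a k /p^ ℓ)) ⟨
    (+ high e ℤ.+ Fe) ℤ.- (+ high e ℤ.+ Ff)  ≡⟨ cancel (+ high e) Fe Ff ⟩
    Fe ℤ.- Ff                                ∎
    where
    open ≡-Reasoning
    high : ∀ {n} → (Fin n → Fin d → ℕ) → ℕ
    high w = sumℕ (λ i → dotℕ (w i) (λ k → a k /p^ ℓ))
    Fe Ff : ℤ
    Fe = sumℤ (λ i → floor (dot (e i) (fracDiv p ℓ a)))
    Ff = sumℤ (λ j → floor (dot (f j) (fracDiv p ℓ a)))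
    cancel : ∀ (x y z : ℤ) → (x ℤ.+ y) ℤ.- (x ℤ.+ z) ≡ y ℤ.- z
    cancel = solve-∀

lemma15 : ∀ {d q₁ q₂ : ℕ} (e : Fin q₁ → Fin d → ℕ) (f : Fin q₂ → Fin d → ℕ) →
    -- the vectors are nonzero
    (∀ i → ¬ (∀ k → e i k ≡ 0)) → (∀ j → ¬ (∀ k → f j k ≡ 0)) →
    -- e and f are disjoint
    (∀ i j → ¬ (∀ k → e i k ≡ f j k)) →
    -- |e| = |f|
    (∀ k → sumℕ (λ i → e i k) ≡ sumℕ (λ j → f j k)) →
    -- Δ ≥ 0 on [0,1]^d
    (∀ (x : Fin d → ℚ) → (∀ k → ℚ.0ℚ ℚ.≤ x k) → (∀ k → x k ℚ.≤ ℚ.1ℚ) → + 0 ℤ.≤ Setup.Δ e f x) →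
    -- Δ ≥ 1 on 𝒟
    (∀ (x : Fin d → ℚ) → Setup.InD e f x → + 1 ℤ.≤ Setup.Δ e f x) →
    ∀ (p : ℕ) → Prime p →
    ∀ (s : ℕ) (a : Fin d → ℕ) → Setup.InΨ e f p s a →
    Setup.vpQ e f p a ≡ sumFrom1ℤ s (λ ℓ → Setup.Δ e f (Setup.fracDiv e f p ℓ a))
lemma15 {d} e f _ _ _ |e|≡|f| _ _ p p-prime s a a∈Ψ = begin
  vpQ p a                                                  ≡⟨ cong₂ ℤ._-_ (legendre-on e (λ i x h → inj₁ (i , h)))
                                                                         (legendre-on f (λ j x h → inj₂ (j , h))) ⟩
  sumFrom1ℤ s (levelSum e) ℤ.- sumFrom1ℤ s (levelSum f)    ≡⟨ sumFrom1ℤ-- s (levelSum e) (levelSum f) ⟨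
  sumFrom1ℤ s (λ ℓ → levelSum e ℓ ℤ.- levelSum f ℓ)        ≡⟨ sumFrom1ℤ-cong s (λ l → level-identity a (suc l)) ⟩
  sumFrom1ℤ s (λ ℓ → Δ (fracDiv p ℓ a))                    ∎
  where
  open ≡-Reasoning
  instance
    p-nontrivial : NonTrivial p
    p-nontrivial = prime⇒nonTrivial p-prime
    p≢0 : NonZero p
    p≢0 = nonTrivial⇒nonZero p
  open Setup e f
  open Digits p
  open Valuation p p-prime
  open Bound e f p
  open Levels e f |e|≡|f| p

  levelSum : ∀ {n} → (Fin n → Fin d → ℕ) → ℕ → ℤ
  levelSum w ℓ = sumℤ (λ i → + (dotℕ (w i) a /p^ ℓ))

  -- By the bound, Legendre's formula with s terms applies to each (w_i·a)!.
  legendre-on : ∀ {n} (w : Fin n → Fin d → ℕ) → (∀ i → Among (w i)) →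
    sumℤ (λ i → + vp p (dotℕ (w i) a !)) ≡ sumFrom1ℤ s (levelSum w)
  legendre-on w among = trans (sumℤ-cong (λ i → legendre s (dotℕ (w i) a) (dot-bound (w i) (among i) s a a∈Ψ)))
                              (sumℤ-sumFrom1ℤ s (λ i ℓ → + (dotℕ (w i) a /p^ ℓ)))
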